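{- Let $q$ be a prime power, $0<k<n$ and $0\le t\le k$ integers, and suppose that the graph $\Delta_t(n,k-1)$ is connected. Then: (1) all elements of $\mathcal{C}_t(n,k)\setminus\mathcal{I}_t(n,k)$ belong to the same connected component of $\Lambda_t(n,k)$; in particular $\widetilde{\Lambda}_t(n,k)$ is connected; (2) any two codes in $\mathcal{C}_t(n,k)\setminus\mathcal{I}_t(n,k)$ are at distance at most $\mathrm{diam}(\Delta_t(n,k-1))+1$ in $\Lambda_t(n,k)$.
   Context: Let $V=\mathbb{F}_q^n$. An $[n,m]$-linear code is an $m$-dimensional subspace of $V$; $\mathcal{C}_t(n,m)$ denotes the set of $[n,m]$-codes such that any $t$ columns of a generator matrix (an $m\times n$ matrix whose rows form a basis) are linearly independent. $\Delta_t(n,m)$ is the graph on $\mathcal{C}_t(n,m)$ with $X\sim Y$ iff $\dim(X\cap Y)=m-1$. $\Lambda_t(n,k)$ is the graph on $\mathcal{C}_t(n,k)$ with $X\sim Y$ iff $X\cap Y\in\mathcal{C}_t(n,k-1)$. A code $C\in\mathcal{C}_t(n,k)$ is isolated if it contains no subspace in $\mathcal{C}_t(n,k-1)$; $\mathcal{I}_t(n,k)$ is the set of isolated codes; $\widetilde{\Lambda}_t(n,k)$ is the subgraph of $\Lambda_t(n,k)$ induced on $\mathcal{C}_t(n,k)\setminus\mathcal{I}_t(n,k)$. The diameter of a graph is the maximum graph distance between two of its vertices. -}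

module Defs where

open import Level using (Level; _⊔_)
open import Algebra.Bundles using (CommutativeRing)
open import Data.Nat as ℕ using (ℕ; zero; suc; _^_; _≤_)
open import Data.Nat.Primality using (Prime)
open import Data.Fin using (Fin; zero; suc)
open import Data.Product using (Σ; ∃; ∃-syntax; _×_; _,_)
open import Relation.Binary.PropositionalEquality using (_≡_)
open import Relation.Nullary using (¬_)

IsPrimePower : ℕ → Set
IsPrimePower q = ∃[ p ] ∃[ e ] (Prime p × 1 ≤ e × q ≡ p ^ e)

record Field (c ℓ : Level) : Set (Level.suc (c ⊔ ℓ)) where
  field
    commRing : CommutativeRing c ℓ
  open CommutativeRing commRing public
  field
    1≉0     : ¬ (1# ≈ 0#)
    inverse : ∀ x → ¬ (x ≈ 0#) → ∃[ y ] (x * y ≈ 1#)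

HasSize : ∀ {c ℓ} → Field c ℓ → ℕ → Set (c ⊔ ℓ)
HasSize F q = Σ (Fin q → Carrier) λ f → (∀ i j → f i ≈ f j → i ≡ j) × (∀ x → ∃[ i ] (f i ≈ x))
  where open Field F

module LinearCodes {c ℓ} (F : Field c ℓ) where
  open Field F using (Carrier; _≈_; _+_; _*_; 0#; 1#)

  Vec : ℕ → Set c
  Vec n = Fin n → Carrier

  _≈ᵥ_ : ∀ {n} → Vec n → Vec n → Set ℓ
  u ≈ᵥ v = ∀ i → u i ≈ v i

  0ᵥ : ∀ {n} → Vec n
  0ᵥ _ = 0#

  _+ᵥ_ : ∀ {n} → Vec n → Vec n → Vec n
  (u +ᵥ v) i = u i + v i

  _·_ : ∀ {n} → Carrier → Vec n → Vec n
  (a · v) i = a * v i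

  lincomb : ∀ {m n} → (Fin m → Carrier) → (Fin m → Vec n) → Vec n
  lincomb {zero}  a b = 0ᵥ
  lincomb {suc m} a b = (a zero · b zero) +ᵥ lincomb (λ i → a (suc i)) (λ i → b (suc i))

  LinIndep : ∀ {m n} → (Fin m → Vec n) → Set (c ⊔ ℓ)
  LinIndep {m} b = ∀ (a : Fin m → Carrier) → lincomb a b ≈ᵥ 0ᵥ → ∀ i → a i ≈ 0#

  -- subsets of F^n (codes are represented by their membership predicate)
  Sub : ℕ → Set (Level.suc (c ⊔ ℓ))
  Sub n = Vec n → Set (c ⊔ ℓ)

  Span : ∀ {m n} → (Fin m → Vec n) → Sub n
  Span {m} b v = ∃[ a ] (lincomb {m} a b ≈ᵥ v)

  _≐_ : ∀ {n} → Sub n → Sub n → Set (c ⊔ ℓ)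
  X ≐ Y = ∀ v → (X v → Y v) × (Y v → X v)

  _⊆_ : ∀ {n} → Sub n → Sub n → Set (c ⊔ ℓ)
  X ⊆ Y = ∀ v → X v → Y v

  _∩_ : ∀ {n} → Sub n → Sub n → Sub n
  (X ∩ Y) v = X v × Y v

  -- b is a basis of X (rows of a generator matrix of X)
  IsBasis : ∀ {m n} → (Fin m → Vec n) → Sub n → Set (c ⊔ ℓ)
  IsBasis b X = LinIndep b × (Span b ≐ X)

  HasDim : ∀ {n} → Sub n → ℕ → Set (c ⊔ ℓ)
  HasDim {n} X m = ∃[ b ] IsBasis {m} {n} b X

  Injective : ∀ {t n} → (Fin t → Fin n) → Set
  Injective s = ∀ i j → s i ≡ s j → i ≡ j

  -- the columns s(0),…,s(t-1) of the m×n matrix G (rows b i) are linearly independent in F^m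
  ColumnsIndep : ∀ {t m n} → (Fin m → Vec n) → (Fin t → Fin n) → Set (c ⊔ ℓ)
  ColumnsIndep b s = LinIndep (λ j i → b i (s j))

  𝒞 : (t n m : ℕ) → Sub n → Set (c ⊔ ℓ)
  𝒞 t n m X = ∃[ b ] (IsBasis {m} {n} b X × (∀ (s : Fin t → Fin n) → Injective s → ColumnsIndep b s))

  Δ-adj : (t n m : ℕ) → Sub n → Sub n → Set (c ⊔ ℓ)
  Δ-adj t n m X Y = HasDim (X ∩ Y) (m ℕ.∸ 1)

  Λ-adj : (t n k : ℕ) → Sub n → Sub n → Set (c ⊔ ℓ)
  Λ-adj t n k X Y = 𝒞 t n (k ℕ.∸ 1) (X ∩ Y)

  Isolated : (t n k : ℕ) → Sub n → Set (Level.suc (c ⊔ ℓ))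
  Isolated t n k X = ¬ (∃[ D ] (D ⊆ X × 𝒞 t n (k ℕ.∸ 1) D))

  -- walks of length ℓ in the graph with vertex set V and adjacency A;
  -- vertices are codes, identified up to extensional equality ≐
  data Walk {n} (V : Sub n → Set (c ⊔ ℓ))
            (A : Sub n → Sub n → Set (c ⊔ ℓ))
            : Sub n → Sub n → ℕ → Set (Level.suc (c ⊔ ℓ)) where
    here : ∀ {X Y} → X ≐ Y → Walk V A X Y 0
    step : ∀ {X Y Z l} → V Y → A X Y → Walk V A Y Z l → Walk V A X Z (suc l)

  Connected : ∀ {n} → (Sub n → Set (c ⊔ ℓ)) → (Sub n → Sub n → Set (c ⊔ ℓ)) → Set (Level.suc (c ⊔ ℓ))
  Connected V A = ∀ X Y → V X → V Y → ∃[ l ] Walk V A X Y l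

  DiamAtMost : ∀ {n} → (Sub n → Set (c ⊔ ℓ)) → (Sub n → Sub n → Set (c ⊔ ℓ)) → ℕ → Set (Level.suc (c ⊔ ℓ))
  DiamAtMost V A D = ∀ X Y → V X → V Y → ∃[ l ] (l ≤ D × Walk V A X Y l)

-- Let D ⊆ X and D' ⊆ Y be subcodes in 𝒞_t(n,k-1), and D = P₀ ~ P₁ ~ ⋯ ~ P_l = D' a walk
-- in Δ_t(n,k-1). Consecutive Pᵢ, Pᵢ₊₁ meet in a hyperplane of both, so they span a
-- k-space Eᵢ ⊇ Pᵢ ∪ Pᵢ₊₁, which lies in 𝒞_t(n,k) because column independence passes
-- from a subspace to a superspace. Two k-spaces through the same (k-1)-space P are
-- equal or meet exactly in P, so X, E₀, …, E_{l-1}, Y is a walk in Λ_t(n,k) once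
-- repeated vertices are dropped; its length is at most l + 1.
-- Finiteness of F is used only to decide equality and membership in spans.
module Submission where

open import Defs
open import Level using (_⊔_; Setω)
open import Data.Nat using (ℕ; zero; suc; _≤_; z≤n; s≤s)
open import Data.Nat.Properties using (≤-refl; ≤-trans; n≤1+n; m≤n⇒m≤1+n; 1+n≰n)
open import Data.Fin using (Fin; zero; suc; punchIn) renaming (_≟_ to _≟ᶠ_)
open import Data.Fin.Properties using (any?; all?)
open import Data.Vec.Functional using (_∷_; tail; insertAt)
open import Data.Vec.Functional.Properties using (insertAt-lookup; insertAt-punchIn)
open import Data.Vec.Functional.Relation.Binary.Pointwise using (Pointwise)
open import Data.Product using (∃; ∃-syntax; _×_; _,_; proj₁; proj₂)
open import Data.Sum using (_⊎_; inj₁; inj₂)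
open import Data.Empty using (⊥-elim)
open import Function using (_∘_)
open import Relation.Nullary using (¬_; Dec; yes; no; _×-dec_; _→-dec_)
open import Relation.Nullary.Decidable using (¬?; decidable-stable)
open import Relation.Unary using () renaming (Decidable to Decidableᵘ)
open import Relation.Binary.Definitions using (Reflexive; Symmetric; _Respects_; Decidable)
open import Relation.Binary.PropositionalEquality as ≡ using (_≡_)
import Algebra.Properties.Semiring.Sum as SumProperties
import Algebra.Properties.Ring as RingProperties
import Algebra.Properties.Group as GroupProperties
import Algebra.Properties.CommutativeSemigroup as CommutativeSemigroupProperties
import Relation.Binary.Reasoning.Setoid as SetoidReasoning

Searchable : ∀ {a r} (A : Set a) → (A → A → Set r) → Setω
Searchable A _~_ = ∀ {p} (P : A → Set p) → P Respects _~_ → Decidableᵘ P → Dec (∃ P)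

enumeration⇒searchable : ∀ {a r s} {A : Set a} {_~_ : A → A → Set s} (e : Fin r → A) →
                         (∀ x → ∃[ i ] (x ~ e i)) → Searchable A _~_
enumeration⇒searchable e onto P resp P? with any? (P? ∘ e)
... | yes (i , p) = yes (e i , p)
... | no ¬p = no λ (x , px) → ¬p (proj₁ (onto x) , resp (proj₂ (onto x)) px)

Fin-searchable : ∀ {r} → Searchable (Fin r) _≡_
Fin-searchable = enumeration⇒searchable (λ i → i) (λ i → i , ≡.refl)

Vector-searchable : ∀ {a s} {A : Set a} {_~_ : A → A → Set s} → Reflexive _~_ →
                    Searchable A _~_ → ∀ m → Searchable (Fin m → A) (Pointwise _~_)
Vector-searchable refl search zero P resp P? with P? (λ ())
... | yes p = yes (_ , p)
... | no ¬p = no λ (xs , pxs) → ¬p (resp (λ ()) pxs)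
Vector-searchable {_~_ = _~_} refl search (suc m) P resp P?
  with search (λ x → ∃ λ xs → P (x ∷ xs)) resp-head head?
  where
  resp-head : (λ x → ∃ λ xs → P (x ∷ xs)) Respects _~_
  resp-head x~y (xs , pxs) = xs , resp (λ { zero → x~y ; (suc i) → refl }) pxs
  head? : Decidableᵘ (λ x → ∃ λ xs → P (x ∷ xs))
  head? x = Vector-searchable refl search m (λ xs → P (x ∷ xs))
              (λ xs~ys → resp λ { zero → refl ; (suc i) → xs~ys i }) (P? ∘ (x ∷_))
... | yes (x , xs , pxs) = yes (x ∷ xs , pxs)
... | no ¬p = no λ (xs , pxs) →
        ¬p (xs zero , tail xs , resp (λ { zero → refl ; (suc i) → refl }) pxs)

searchable⇒∀? : ∀ {a s p} {A : Set a} {_~_ : A → A → Set s} {P : A → Set p} → Symmetric _~_ →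
                Searchable A _~_ → P Respects _~_ → Decidableᵘ P → Dec (∀ x → P x)
searchable⇒∀? {P = P} sym search resp P?
  with search (¬_ ∘ P) (λ x~y ¬px py → ¬px (resp (sym x~y) py)) (¬? ∘ P?)
... | yes (x , ¬px) = no λ all → ¬px (all x)
... | no ¬∃ = yes λ x → decidable-stable (P? x) (λ ¬px → ¬∃ (x , ¬px))

module _ {c ℓ} (F : Field c ℓ) where
  open Field F

  HasSize⇒searchable : ∀ {q} → HasSize F q → Searchable Carrier _≈_
  HasSize⇒searchable (enum , _ , onto) =
    enumeration⇒searchable enum (λ x → proj₁ (onto x) , sym (proj₂ (onto x)))

  HasSize⇒decidable : ∀ {q} → HasSize F q → Decidable _≈_
  HasSize⇒decidable (enum , injective , onto) x y with proj₁ (onto x) ≟ᶠ proj₁ (onto y)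
  ... | yes i≡j = yes (trans (sym (proj₂ (onto x))) (trans (reflexive (≡.cong enum i≡j)) (proj₂ (onto y))))
  ... | no i≢j = no λ x≈y → i≢j (injective _ _ (trans (proj₂ (onto x)) (trans x≈y (sym (proj₂ (onto y))))))

module LinearAlgebra {c ℓ} (F : Field c ℓ) (_≟_ : Decidable (Field._≈_ F))
                     (search : Searchable (Field.Carrier F) (Field._≈_ F)) where
  open Field F hiding (zero)
  open LinearCodes F
  open SumProperties semiring
    using (sum; sum-cong-≋; sum-remove; sum-replicate-zero; ∑-distrib-+; ∑-comm; *-distribˡ-sum; *-distribʳ-sum)
  open RingProperties ring using (-1*x≈-x; -‿distribˡ-*)
  open GroupProperties +-group using (⁻¹-involutive; ε⁻¹≈ε)
  open CommutativeSemigroupProperties *-commutativeSemigroup using (x∙yz≈y∙xz)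
  open SetoidReasoning setoid

  -1≉0 : ¬ (- 1# ≈ 0#)
  -1≉0 -1≈0 = 1≉0 (begin
    1#         ≈⟨ sym (⁻¹-involutive 1#) ⟩
    - (- 1#)   ≈⟨ -‿cong -1≈0 ⟩
    - 0#       ≈⟨ ε⁻¹≈ε ⟩
    0#         ∎)

  zero-term : ∀ {a x l r} → a ≈ 0# → a * x + l ≈ r → l ≈ r
  zero-term {a} {x} {l} {r} a≈0 eq = begin
    l          ≈⟨ sym (+-identityˡ l) ⟩
    0# + l     ≈⟨ +-congʳ (sym (trans (*-congʳ a≈0) (zeroˡ x))) ⟩
    a * x + l  ≈⟨ eq ⟩
    r          ∎

  solve-pivot : ∀ {a y} → a * y ≈ 1# → ∀ w l → y * ((a * w + l) + - 1# * l) ≈ w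
  solve-pivot {a} {y} ay≈1 w l = begin
    y * ((a * w + l) + - 1# * l)  ≈⟨ *-congˡ (+-congˡ (-1*x≈-x l)) ⟩
    y * ((a * w + l) + - l)       ≈⟨ *-congˡ (+-assoc _ _ _) ⟩
    y * (a * w + (l + - l))       ≈⟨ *-congˡ (+-congˡ (-‿inverseʳ l)) ⟩
    y * (a * w + 0#)              ≈⟨ *-congˡ (+-identityʳ _) ⟩
    y * (a * w)                   ≈⟨ sym (*-assoc y a w) ⟩
    y * a * w                     ≈⟨ *-congʳ (trans (*-comm y a) ay≈1) ⟩
    1# * w                        ≈⟨ *-identityˡ w ⟩
    w                             ∎

  eliminate-pivot : ∀ {a y} → a * y ≈ 1# → ∀ x → x + - (x * y) * a ≈ 0#
  eliminate-pivot {a} {y} ay≈1 x = begin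
    x + - (x * y) * a  ≈⟨ +-congˡ (sym (-‿distribˡ-* (x * y) a)) ⟩
    x + - (x * y * a)  ≈⟨ +-congˡ (-‿cong (*-assoc x y a)) ⟩
    x + - (x * (y * a)) ≈⟨ +-congˡ (-‿cong (*-congˡ (trans (*-comm y a) ay≈1))) ⟩
    x + - (x * 1#)     ≈⟨ +-congˡ (-‿cong (*-identityʳ x)) ⟩
    x + - x            ≈⟨ -‿inverseʳ x ⟩
    0#                 ∎

  dot : ∀ {m} → (Fin m → Carrier) → (Fin m → Carrier) → Carrier
  dot a w = sum (λ i → a i * w i)

  dot-cong : ∀ {m} {a a' w w' : Fin m → Carrier} →
             Pointwise _≈_ a a' → Pointwise _≈_ w w' → dot a w ≈ dot a' w'
  dot-cong {a = a} {a'} {w} {w'} a≈a' w≈w' =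
    sum-cong-≋ {x = λ i → a i * w i} {λ i → a' i * w' i} (λ i → *-cong (a≈a' i) (w≈w' i))

  dot-comm : ∀ {m} (a w : Fin m → Carrier) → dot a w ≈ dot w a
  dot-comm a w = sum-cong-≋ {x = λ i → a i * w i} {λ i → w i * a i} (λ i → *-comm (a i) (w i))

  dot-zeroˡ : ∀ {m} (w : Fin m → Carrier) → dot (λ _ → 0#) w ≈ 0#
  dot-zeroˡ {m} w = trans (sum-cong-≋ {x = λ i → 0# * w i} {λ _ → 0#} (λ i → zeroˡ (w i))) (sum-replicate-zero m)

  dot-zeroʳ : ∀ {m} (a : Fin m → Carrier) → dot a (λ _ → 0#) ≈ 0#
  dot-zeroʳ a = trans (dot-comm a _) (dot-zeroˡ a)

  dot-distribʳ-+ : ∀ {m} (a a' w : Fin m → Carrier) → dot (λ i → a i + a' i) w ≈ dot a w + dot a' w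
  dot-distribʳ-+ a a' w =
    trans (sum-cong-≋ {x = λ i → (a i + a' i) * w i} (λ i → distribʳ (w i) (a i) (a' i)))
          (∑-distrib-+ (λ i → a i * w i) (λ i → a' i * w i))

  dot-distribˡ-+ : ∀ {m} (a w w' : Fin m → Carrier) → dot a (λ i → w i + w' i) ≈ dot a w + dot a w'
  dot-distribˡ-+ a w w' =
    trans (sum-cong-≋ {x = λ i → a i * (w i + w' i)} (λ i → distribˡ (a i) (w i) (w' i)))
          (∑-distrib-+ (λ i → a i * w i) (λ i → a i * w' i))

  dot-*ˡ : ∀ {m} r (a w : Fin m → Carrier) → dot (λ i → r * a i) w ≈ r * dot a w
  dot-*ˡ r a w = sym (trans (*-distribˡ-sum r (λ i → a i * w i))
                            (sum-cong-≋ {x = λ i → r * (a i * w i)} (λ i → sym (*-assoc r (a i) (w i)))))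

  dot-*ʳ : ∀ {m} (a w : Fin m → Carrier) x → dot a (λ i → w i * x) ≈ dot a w * x
  dot-*ʳ a w x = sym (trans (*-distribʳ-sum x (λ i → a i * w i))
                            (sum-cong-≋ {x = λ i → a i * w i * x} (λ i → *-assoc (a i) (w i) x)))

  dot-swap : ∀ {m p} (a : Fin m → Carrier) (e : Fin p → Carrier) (M : Fin p → Fin m → Carrier) →
             dot a (λ j → dot e (λ i → M i j)) ≈ dot e (λ i → dot a (M i))
  dot-swap {m} {p} a e M = begin
    sum (λ j → a j * sum (λ i → e i * M i j))        ≈⟨ sum-cong-≋ (λ j → *-distribˡ-sum (a j) (λ i → e i * M i j)) ⟩
    sum (λ j → sum (λ i → a j * (e i * M i j)))      ≈⟨ ∑-comm {m} {p} (λ j i → a j * (e i * M i j)) ⟩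
    sum (λ i → sum (λ j → a j * (e i * M i j)))      ≈⟨ sum-cong-≋ (λ i → sum-cong-≋ (λ j → x∙yz≈y∙xz (a j) (e i) (M i j))) ⟩
    sum (λ i → sum (λ j → e i * (a j * M i j)))      ≈⟨ sum-cong-≋ (λ i → sym (*-distribˡ-sum (e i) (λ j → a j * M i j))) ⟩
    sum (λ i → e i * sum (λ j → a j * M i j))        ∎

  dot-remove : ∀ {m} (i : Fin (suc m)) (a w : Fin (suc m) → Carrier) →
               dot a w ≈ a i * w i + dot (a ∘ punchIn i) (w ∘ punchIn i)
  dot-remove i a w = sum-remove {i = i} (λ j → a j * w j)

  δ : ∀ {m} → Fin m → Fin m → Carrier
  δ zero    zero    = 1#
  δ zero    (suc j) = 0#
  δ (suc i) zero    = 0#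
  δ (suc i) (suc j) = δ i j

  dot-δ : ∀ {m} (i : Fin m) (w : Fin m → Carrier) → dot (δ i) w ≈ w i
  dot-δ zero    w = trans (+-cong (*-identityˡ _) (dot-zeroˡ (tail w))) (+-identityʳ _)
  dot-δ (suc i) w = trans (+-cong (zeroˡ _) (dot-δ i (tail w))) (+-identityˡ _)

  lincomb-pointwise : ∀ {m n} (a : Fin m → Carrier) (b : Fin m → Vec n) j →
                      lincomb a b j ≈ dot a (λ i → b i j)
  lincomb-pointwise {zero}  a b j = refl
  lincomb-pointwise {suc m} a b j = +-congˡ (lincomb-pointwise (tail a) (tail b) j)

  ≈ᵥ-refl : ∀ {n} {u : Vec n} → u ≈ᵥ u
  ≈ᵥ-refl i = refl

  ≈ᵥ-sym : ∀ {n} {u v : Vec n} → u ≈ᵥ v → v ≈ᵥ u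
  ≈ᵥ-sym u≈v i = sym (u≈v i)

  ≈ᵥ-trans : ∀ {n} {u v w : Vec n} → u ≈ᵥ v → v ≈ᵥ w → u ≈ᵥ w
  ≈ᵥ-trans u≈v v≈w i = trans (u≈v i) (v≈w i)

  lincomb-cong : ∀ {m n} {a a' : Fin m → Carrier} {b b' : Fin m → Vec n} →
                 Pointwise _≈_ a a' → Pointwise _≈ᵥ_ b b' → lincomb a b ≈ᵥ lincomb a' b'
  lincomb-cong {zero}  a≈a' b≈b' j = refl
  lincomb-cong {suc m} a≈a' b≈b' j =
    +-cong (*-cong (a≈a' zero) (b≈b' zero j)) (lincomb-cong (a≈a' ∘ suc) (b≈b' ∘ suc) j)

  ⊆-trans : ∀ {n} {X Y Z : Sub n} → X ⊆ Y → Y ⊆ Z → X ⊆ Z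
  ⊆-trans X⊆Y Y⊆Z v = Y⊆Z v ∘ X⊆Y v

  ⊆-antisym : ∀ {n} {X Y : Sub n} → X ⊆ Y → Y ⊆ X → X ≐ Y
  ⊆-antisym X⊆Y Y⊆X v = X⊆Y v , Y⊆X v

  ≐⇒⊆ : ∀ {n} {X Y : Sub n} → X ≐ Y → X ⊆ Y
  ≐⇒⊆ X≐Y v = proj₁ (X≐Y v)

  ≐⇒⊇ : ∀ {n} {X Y : Sub n} → X ≐ Y → Y ⊆ X
  ≐⇒⊇ X≐Y v = proj₂ (X≐Y v)

  ≐-refl : ∀ {n} {X : Sub n} → X ≐ X
  ≐-refl v = (λ x → x) , (λ x → x)

  ≐-sym : ∀ {n} {X Y : Sub n} → X ≐ Y → Y ≐ X
  ≐-sym X≐Y = ⊆-antisym (≐⇒⊇ X≐Y) (≐⇒⊆ X≐Y)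

  ≐-trans : ∀ {n} {X Y Z : Sub n} → X ≐ Y → Y ≐ Z → X ≐ Z
  ≐-trans X≐Y Y≐Z = ⊆-antisym (⊆-trans (≐⇒⊆ X≐Y) (≐⇒⊆ Y≐Z)) (⊆-trans (≐⇒⊇ Y≐Z) (≐⇒⊇ X≐Y))

  ∩-respˡ-≐ : ∀ {n} {X X' Y : Sub n} → X ≐ X' → (X ∩ Y) ≐ (X' ∩ Y)
  ∩-respˡ-≐ X≐X' v = (λ (x , y) → ≐⇒⊆ X≐X' v x , y) , (λ (x' , y) → ≐⇒⊇ X≐X' v x' , y)

  Span-resp : ∀ {m n} {b : Fin m → Vec n} → Span b Respects _≈ᵥ_
  Span-resp u≈v (a , a≈u) = a , ≈ᵥ-trans a≈u u≈v

  Span-0ᵥ : ∀ {m n} (b : Fin m → Vec n) → Span b 0ᵥ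
  Span-0ᵥ b = (λ _ → 0#) , λ j → trans (lincomb-pointwise _ b j) (dot-zeroˡ (λ i → b i j))

  Span-+ᵥ : ∀ {m n} {b : Fin m → Vec n} {u v} → Span b u → Span b v → Span b (u +ᵥ v)
  Span-+ᵥ {b = b} {u} {v} (a , a≈u) (a' , a'≈v) = (λ i → a i + a' i) , λ j → begin
    lincomb (λ i → a i + a' i) b j             ≈⟨ lincomb-pointwise _ b j ⟩
    dot (λ i → a i + a' i) (λ i → b i j)       ≈⟨ dot-distribʳ-+ a a' _ ⟩
    dot a (λ i → b i j) + dot a' (λ i → b i j) ≈⟨ +-cong (sym (lincomb-pointwise a b j)) (sym (lincomb-pointwise a' b j)) ⟩
    lincomb a b j + lincomb a' b j             ≈⟨ +-cong (a≈u j) (a'≈v j) ⟩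
    u j + v j                                  ∎

  Span-· : ∀ {m n} {b : Fin m → Vec n} {v} r → Span b v → Span b (r · v)
  Span-· {b = b} {v} r (a , a≈v) = (λ i → r * a i) , λ j → begin
    lincomb (λ i → r * a i) b j    ≈⟨ lincomb-pointwise _ b j ⟩
    dot (λ i → r * a i) (λ i → b i j) ≈⟨ dot-*ˡ r a _ ⟩
    r * dot a (λ i → b i j)        ≈⟨ *-congˡ (sym (lincomb-pointwise a b j)) ⟩
    r * lincomb a b j              ≈⟨ *-congˡ (a≈v j) ⟩
    r * v j                        ∎

  Span-generator : ∀ {m n} (b : Fin m → Vec n) i → Span b (b i)
  Span-generator b i = δ i , λ j → trans (lincomb-pointwise _ b j) (dot-δ i (λ k → b k j))

  Span-lincomb : ∀ {m p n} {b : Fin m → Vec n} {d : Fin p → Vec n} →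
                 (∀ i → Span d (b i)) → ∀ a → Span d (lincomb a b)
  Span-lincomb {zero}  {d = d} b⊆d a = Span-0ᵥ d
  Span-lincomb {suc m}         b⊆d a = Span-+ᵥ (Span-· (a zero) (b⊆d zero)) (Span-lincomb (b⊆d ∘ suc) (tail a))

  Span-⊆ : ∀ {m p n} {b : Fin m → Vec n} {d : Fin p → Vec n} → (∀ i → Span d (b i)) → Span b ⊆ Span d
  Span-⊆ b⊆d v (a , a≈v) = Span-resp a≈v (Span-lincomb b⊆d a)

  -- w = a₀⁻¹ (Σᵢ aᵢ (w ∷ d)ᵢ - Σᵢ aᵢ₊₁ dᵢ)
  Span-cancel : ∀ {m p n} {d : Fin m → Vec n} {b : Fin p → Vec n} {w} (a : Fin (suc m) → Carrier) →
                ¬ (a zero ≈ 0#) → Span d ⊆ Span b → Span b (lincomb a (w ∷ d)) → Span b w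
  Span-cancel {d = d} {b} {w} a a₀≉0 d⊆b comb∈b =
    Span-resp (λ j → solve-pivot a₀y≈1 (w j) (rest j)) (Span-· y (Span-+ᵥ comb∈b (Span-· (- 1#) rest∈b)))
    where
    y = proj₁ (inverse (a zero) a₀≉0)
    a₀y≈1 = proj₂ (inverse (a zero) a₀≉0)
    rest = lincomb (tail a) d
    rest∈b : Span b rest
    rest∈b = d⊆b rest (tail a , ≈ᵥ-refl)

  LinIndep-resp : ∀ {m n} {b b' : Fin m → Vec n} → Pointwise _≈ᵥ_ b b' → LinIndep b → LinIndep b'
  LinIndep-resp b≈b' ind a comb≈0 = ind a (≈ᵥ-trans (lincomb-cong (λ _ → refl) b≈b') comb≈0)

  ∷-independent : ∀ {m n} {d : Fin m → Vec n} {v : Vec n} → LinIndep d → ¬ Span d v → LinIndep (v ∷ d)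
  ∷-independent {d = d} ind v∉d a comb≈0 with a zero ≟ 0#
  ... | no a₀≉0 = ⊥-elim (v∉d (Span-cancel a a₀≉0 (λ _ v∈d → v∈d) (Span-resp (≈ᵥ-sym comb≈0) (Span-0ᵥ d))))
  ... | yes a₀≈0 = λ where
    zero    → a₀≈0
    (suc i) → ind (tail a) (λ j → zero-term a₀≈0 (comb≈0 j)) i

  ∷-dependent : ∀ {m n} {d : Fin m → Vec n} {v : Vec n} → Span d v → ¬ LinIndep (v ∷ d)
  ∷-dependent {v = v} (a , a≈v) ind = -1≉0 (ind (- 1# ∷ a) comb≈0 zero)
    where
    comb≈0 : lincomb (- 1# ∷ a) (v ∷ _) ≈ᵥ 0ᵥ
    comb≈0 j = trans (+-cong (-1*x≈-x (v j)) (a≈v j)) (-‿inverseˡ (v j))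

  independent-tails : ∀ {m p} {v : Fin m → Vec (suc p)} →
                      (∀ i → v i zero ≈ 0#) → LinIndep v → LinIndep (tail ∘ v)
  independent-tails {v = v} v₀≈0 ind a tails≈0 = ind a λ where
    zero → begin
      lincomb a v zero         ≈⟨ lincomb-pointwise a v zero ⟩
      dot a (λ i → v i zero)   ≈⟨ dot-cong (λ _ → refl) v₀≈0 ⟩
      dot a (λ _ → 0#)         ≈⟨ dot-zeroʳ a ⟩
      0#                       ∎
    (suc j) → begin
      lincomb a v (suc j)      ≈⟨ lincomb-pointwise a v (suc j) ⟩
      dot a (λ i → v i (suc j)) ≈⟨ sym (lincomb-pointwise a (tail ∘ v) j) ⟩
      lincomb a (tail ∘ v) j   ≈⟨ tails≈0 j ⟩
      0#                       ∎

  -- A relation Σ aⱼ wⱼ = 0 among the wⱼ = v (σ j) + rⱼ v i₀ is the relation among the v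
  -- with coefficients aⱼ at σ j and Σ aⱼ rⱼ at i₀.
  independent-eliminate : ∀ {m n} {v : Fin (suc m) → Vec n} (i₀ : Fin (suc m)) (r : Fin m → Carrier) →
                          LinIndep v → LinIndep (λ j → v (punchIn i₀ j) +ᵥ (r j · v i₀))
  independent-eliminate {v = v} i₀ r ind a comb≈0 j =
    trans (sym (reflexive (insertAt-punchIn a i₀ β j))) (ind (insertAt a i₀ β) lifted≈0 (punchIn i₀ j))
    where
    σ = punchIn i₀
    β = dot a r
    A = insertAt a i₀ β
    lifted≈0 : lincomb A v ≈ᵥ 0ᵥ
    lifted≈0 k = begin
      lincomb A v k                                          ≈⟨ lincomb-pointwise A v k ⟩
      dot A (λ i → v i k)                                    ≈⟨ dot-remove i₀ A (λ i → v i k) ⟩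
      A i₀ * v i₀ k + dot (A ∘ σ) (λ j → v (σ j) k)
        ≈⟨ +-cong (*-congʳ (reflexive (insertAt-lookup a i₀ β)))
                  (dot-cong (reflexive ∘ insertAt-punchIn a i₀ β) (λ _ → refl)) ⟩
      β * v i₀ k + dot a (λ j → v (σ j) k)                   ≈⟨ +-comm _ _ ⟩
      dot a (λ j → v (σ j) k) + β * v i₀ k                   ≈⟨ +-congˡ (sym (dot-*ʳ a r (v i₀ k))) ⟩
      dot a (λ j → v (σ j) k) + dot a (λ j → r j * v i₀ k)   ≈⟨ sym (dot-distribˡ-+ a _ _) ⟩
      dot a (λ j → v (σ j) k + r j * v i₀ k)                 ≈⟨ sym (lincomb-pointwise a _ k) ⟩
      lincomb a (λ j → v (σ j) +ᵥ (r j · v i₀)) k            ≈⟨ comb≈0 k ⟩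
      0#                                                     ∎

  independent⇒≤ : ∀ {m p} (v : Fin m → Vec p) → LinIndep v → m ≤ p
  independent⇒≤ {zero}          v ind = z≤n
  independent⇒≤ {suc m} {zero}  v ind = ⊥-elim (1≉0 (ind (λ _ → 1#) (λ ()) zero))
  independent⇒≤ {suc m} {suc p} v ind with any? (λ i → ¬? (v i zero ≟ 0#))
  ... | no no-pivot = m≤n⇒m≤1+n (independent⇒≤ (tail ∘ v) (independent-tails {v = v} v₀≈0 ind))
    where
    v₀≈0 : ∀ i → v i zero ≈ 0#
    v₀≈0 i = decidable-stable (v i zero ≟ 0#) (no-pivot ∘ (i ,_))
  ... | yes (i₀ , pivot≉0) =
    s≤s (independent⇒≤ (tail ∘ w) (independent-tails {v = w} w₀≈0 (independent-eliminate {v = v} i₀ r ind)))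
    where
    y = proj₁ (inverse (v i₀ zero) pivot≉0)
    r : Fin m → Carrier
    r j = - (v (punchIn i₀ j) zero * y)
    w : Fin m → Vec (suc p)
    w j = v (punchIn i₀ j) +ᵥ (r j · v i₀)
    w₀≈0 : ∀ j → w j zero ≈ 0#
    w₀≈0 j = eliminate-pivot (proj₂ (inverse (v i₀ zero) pivot≉0)) (v (punchIn i₀ j) zero)

  independent-⊆-Span⇒≤ : ∀ {m p n} {b : Fin m → Vec n} {d : Fin p → Vec n} →
                         LinIndep b → Span b ⊆ Span d → m ≤ p
  independent-⊆-Span⇒≤ {m} {p} {b = b} {d} ind b⊆d = independent⇒≤ coords coords-ind
    where
    coords : Fin m → Vec p
    coords i = proj₁ (b⊆d (b i) (Span-generator b i))
    coords-ind : LinIndep coords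
    coords-ind a comb≈0 = ind a λ k → let u = λ j → d j k in begin
      lincomb a b k                                   ≈⟨ lincomb-pointwise a b k ⟩
      dot a (λ i → b i k)                             ≈⟨ dot-cong (λ _ → refl) (λ i → sym (proj₂ (b⊆d (b i) (Span-generator b i)) k)) ⟩
      dot a (λ i → lincomb (coords i) d k)            ≈⟨ dot-cong (λ _ → refl) (λ i → lincomb-pointwise (coords i) d k) ⟩
      dot a (λ i → dot (coords i) u)                  ≈⟨ dot-cong (λ _ → refl) (λ i → dot-comm (coords i) u) ⟩
      dot a (λ i → dot u (coords i))                  ≈⟨ sym (dot-swap u a coords) ⟩
      dot u (λ j → dot a (λ i → coords i j))          ≈⟨ dot-cong (λ _ → refl) (λ j → trans (sym (lincomb-pointwise a coords j)) (comb≈0 j)) ⟩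
      dot u (λ _ → 0#)                                ≈⟨ dot-zeroʳ u ⟩
      0#                                              ∎

  _≟ᵥ_ : ∀ {n} → Decidable (_≈ᵥ_ {n})
  u ≟ᵥ v = all? (λ i → u i ≟ v i)

  coefficients-searchable : ∀ m → Searchable (Fin m → Carrier) (Pointwise _≈_)
  coefficients-searchable = Vector-searchable refl search

  Span? : ∀ {m n} (b : Fin m → Vec n) → Decidableᵘ (Span b)
  Span? b v = coefficients-searchable _ (λ a → lincomb a b ≈ᵥ v)
    (λ a≈a' comb≈v → ≈ᵥ-trans (lincomb-cong (λ i → sym (a≈a' i)) (λ _ → ≈ᵥ-refl)) comb≈v)
    (λ a → lincomb a b ≟ᵥ v)

  LinIndep? : ∀ {m n} (b : Fin m → Vec n) → Dec (LinIndep b)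
  LinIndep? {m} b with coefficients-searchable m Dependence resp Dependence?
    where
    Dependence : (Fin m → Carrier) → Set ℓ
    Dependence a = lincomb a b ≈ᵥ 0ᵥ × ∃[ i ] ¬ (a i ≈ 0#)
    resp : Dependence Respects Pointwise _≈_
    resp a≈a' (comb≈0 , i , aᵢ≉0) =
      ≈ᵥ-trans (lincomb-cong (λ j → sym (a≈a' j)) (λ _ → ≈ᵥ-refl)) comb≈0 , i , aᵢ≉0 ∘ trans (a≈a' i)
    Dependence? : Decidableᵘ Dependence
    Dependence? a = (lincomb a b ≟ᵥ 0ᵥ) ×-dec any? (λ i → ¬? (a i ≟ 0#))
  ... | yes (a , comb≈0 , i , aᵢ≉0) = no λ ind → aᵢ≉0 (ind a comb≈0 i)
  ... | no independent = yes λ a comb≈0 i →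
          decidable-stable (a i ≟ 0#) (λ aᵢ≉0 → independent (a , comb≈0 , i , aᵢ≉0))

  Span-⊆⇒⊇ : ∀ {m n} {b d : Fin m → Vec n} → LinIndep b → Span b ⊆ Span d → Span d ⊆ Span b
  Span-⊆⇒⊇ {b = b} {d} ind b⊆d = Span-⊆ d∈b
    where
    d∈b : ∀ j → Span b (d j)
    d∈b j with Span? b (d j)
    ... | yes dⱼ∈b = dⱼ∈b
    ... | no dⱼ∉b = ⊥-elim (1+n≰n (independent-⊆-Span⇒≤ {b = d j ∷ b} {d} (∷-independent {d = b} ind dⱼ∉b) dⱼb⊆d))
      where
      dⱼb⊆d : Span (d j ∷ b) ⊆ Span d
      dⱼb⊆d = Span-⊆ {b = d j ∷ b} {d} λ where
        zero    → Span-generator d j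
        (suc i) → b⊆d (b i) (Span-generator b i)

  extend-basis : ∀ {k n} {p : Fin k → Vec n} {x : Fin (suc k) → Vec n} {X : Sub n} →
                 LinIndep p → IsBasis x X → Span p ⊆ X → ∃[ u ] IsBasis (u ∷ p) X
  extend-basis {p = p} {x} p-ind (x-ind , x≐X) p⊆X with any? (λ j → ¬? (Span? p (x j)))
  ... | yes (j , xⱼ∉p) =
    x j , up-ind , ⊆-antisym (⊆-trans up⊆x (≐⇒⊆ x≐X)) (⊆-trans (≐⇒⊇ x≐X) (Span-⊆⇒⊇ {b = x j ∷ p} {x} up-ind up⊆x))
    where
    up-ind : LinIndep (x j ∷ p)
    up-ind = ∷-independent {d = p} p-ind xⱼ∉p
    up⊆x : Span (x j ∷ p) ⊆ Span x
    up⊆x = Span-⊆ {b = x j ∷ p} {x} λ where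
      zero    → Span-generator x j
      (suc i) → ≐⇒⊇ x≐X (p i) (p⊆X (p i) (Span-generator p i))
  ... | no all∈p = ⊥-elim (1+n≰n (independent-⊆-Span⇒≤ {b = x} {p} x-ind (Span-⊆ {b = x} {p} x∈p)))
    where
    x∈p : ∀ j → Span p (x j)
    x∈p j = decidable-stable (Span? p (x j)) (all∈p ∘ (j ,_))

  ∷-Span-∩⊆ : ∀ {k n} {p : Fin k → Vec n} {u w : Vec n} →
              ¬ Span (u ∷ p) w → (Span (u ∷ p) ∩ Span (w ∷ p)) ⊆ Span p
  ∷-Span-∩⊆ {p = p} {u} w∉up v (v∈up , (b , b≈v)) with b zero ≟ 0#
  ... | yes b₀≈0 = tail b , λ j → zero-term b₀≈0 (b≈v j)
  ... | no b₀≉0 = ⊥-elim (w∉up (Span-cancel {d = p} {u ∷ p} b b₀≉0 p⊆up (Span-resp {b = u ∷ p} (≈ᵥ-sym b≈v) v∈up)))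
    where
    p⊆up : Span p ⊆ Span (u ∷ p)
    p⊆up = Span-⊆ {b = p} {u ∷ p} (Span-generator (u ∷ p) ∘ suc)

  equal-or-meet : ∀ {k n} {Z W P : Sub n} → HasDim Z (suc k) → HasDim W (suc k) → HasDim P k →
                  P ⊆ Z → P ⊆ W → Z ≐ W ⊎ (Z ∩ W) ≐ P
  equal-or-meet (z , z-basis) (w , w-basis) (p , p-ind , p≐P) P⊆Z P⊆W
    with extend-basis {p = p} {z} p-ind z-basis (⊆-trans (≐⇒⊆ p≐P) P⊆Z)
       | extend-basis {p = p} {w} p-ind w-basis (⊆-trans (≐⇒⊆ p≐P) P⊆W)
  ... | u , _ , up≐Z | w , wp-ind , wp≐W with Span? (u ∷ p) w
  ... | yes w∈up =
    inj₁ (≐-trans (≐-sym up≐Z) (≐-trans (⊆-antisym (Span-⊆⇒⊇ {b = w ∷ p} {u ∷ p} wp-ind wp⊆up) wp⊆up) wp≐W))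
    where
    wp⊆up : Span (w ∷ p) ⊆ Span (u ∷ p)
    wp⊆up = Span-⊆ {b = w ∷ p} {u ∷ p} λ where
      zero    → w∈up
      (suc i) → Span-generator (u ∷ p) (suc i)
  ... | no w∉up = inj₂ (⊆-antisym Z∩W⊆P (λ v v∈P → P⊆Z v v∈P , P⊆W v v∈P))
    where
    Z∩W⊆P : (_ ∩ _) ⊆ _
    Z∩W⊆P v (v∈Z , v∈W) =
      ≐⇒⊆ p≐P v (∷-Span-∩⊆ w∉up v (≐⇒⊇ up≐Z v v∈Z , ≐⇒⊇ wp≐W v v∈W))

  common-superspace : ∀ {k n} {P P' : Sub n} → HasDim P (suc k) → HasDim P' (suc k) → HasDim (P ∩ P') k →
                      ∃[ e ] (LinIndep {suc (suc k)} e × P ⊆ Span e × P' ⊆ Span e)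
  common-superspace (p , p-basis) (p' , p'-basis) (d , d-ind , d≐PP')
    with extend-basis {p = d} {p} d-ind p-basis (λ v v∈d → proj₁ (≐⇒⊆ d≐PP' v v∈d))
       | extend-basis {p = d} {p'} d-ind p'-basis (λ v v∈d → proj₂ (≐⇒⊆ d≐PP' v v∈d))
  ... | u , ud-ind , ud≐P | w , wd-ind , wd≐P' =
    w ∷ u ∷ d , ∷-independent {d = u ∷ d} ud-ind w∉ud , ⊆-trans (≐⇒⊇ ud≐P) ud⊆wud , ⊆-trans (≐⇒⊇ wd≐P') wd⊆wud
    where
    ud⊆wud : Span (u ∷ d) ⊆ Span (w ∷ u ∷ d)
    ud⊆wud = Span-⊆ {b = u ∷ d} {w ∷ u ∷ d} (Span-generator (w ∷ u ∷ d) ∘ suc)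
    wd⊆wud : Span (w ∷ d) ⊆ Span (w ∷ u ∷ d)
    wd⊆wud = Span-⊆ {b = w ∷ d} {w ∷ u ∷ d} λ where
      zero    → Span-generator (w ∷ u ∷ d) zero
      (suc i) → Span-generator (w ∷ u ∷ d) (suc (suc i))
    w∉ud : ¬ Span (u ∷ d) w
    w∉ud w∈ud =
      ∷-dependent {d = d} (≐⇒⊇ d≐PP' w (≐⇒⊆ ud≐P w w∈ud , ≐⇒⊆ wd≐P' w (Span-generator (w ∷ d) zero))) wd-ind

module CodeGraphs {c ℓ} (F : Field c ℓ) (_≟_ : Decidable (Field._≈_ F))
                  (search : Searchable (Field.Carrier F) (Field._≈_ F)) where
  open Field F hiding (zero)
  open LinearCodes F
  open LinearAlgebra F _≟_ search
  open SetoidReasoning setoid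

  AnyColumnsIndep : ∀ {m n} → ℕ → (Fin m → Vec n) → Set (c ⊔ ℓ)
  AnyColumnsIndep {n = n} t b = ∀ (s : Fin t → Fin n) → Injective s → ColumnsIndep b s

  ColumnsIndep-⊆ : ∀ {t m m' n} {b : Fin m → Vec n} {b' : Fin m' → Vec n} (s : Fin t → Fin n) →
                   Span b' ⊆ Span b → ColumnsIndep b' s → ColumnsIndep b s
  ColumnsIndep-⊆ {b = b} {b'} s b'⊆b b'-ind a comb≈0 = b'-ind a λ i' →
    let e = proj₁ (b'⊆b (b' i') (Span-generator b' i')) in begin
    lincomb a (λ j i → b' i (s j)) i'              ≈⟨ lincomb-pointwise a _ i' ⟩
    dot a (λ j → b' i' (s j))                      ≈⟨ dot-cong (λ _ → refl) (λ j → sym (proj₂ (b'⊆b (b' i') (Span-generator b' i')) (s j))) ⟩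
    dot a (λ j → lincomb e b (s j))                ≈⟨ dot-cong (λ _ → refl) (λ j → lincomb-pointwise e b (s j)) ⟩
    dot a (λ j → dot e (λ i → b i (s j)))          ≈⟨ dot-swap a e (λ i j → b i (s j)) ⟩
    dot e (λ i → dot a (λ j → b i (s j)))          ≈⟨ dot-cong (λ _ → refl) (λ i → trans (sym (lincomb-pointwise a _ i)) (comb≈0 i)) ⟩
    dot e (λ _ → 0#)                               ≈⟨ dot-zeroʳ e ⟩
    0#                                             ∎

  𝒞⇒HasDim : ∀ {t n m} {X : Sub n} → 𝒞 t n m X → HasDim X m
  𝒞⇒HasDim (b , b-basis , _) = b , b-basis

  𝒞-resp-≐ : ∀ {t n m} {X Y : Sub n} → X ≐ Y → 𝒞 t n m X → 𝒞 t n m Y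
  𝒞-resp-≐ X≐Y (b , (b-ind , b≐X) , b-cols) = b , (b-ind , ≐-trans b≐X X≐Y) , b-cols

  𝒞-superspace : ∀ {t n m m'} {P E : Sub n} {e : Fin m → Vec n} →
                 𝒞 t n m' P → IsBasis e E → P ⊆ E → 𝒞 t n m E
  𝒞-superspace {e = e} (p , (_ , p≐P) , p-cols) e-basis@(_ , e≐E) P⊆E =
    e , e-basis , λ s s-inj → ColumnsIndep-⊆ {b = e} {p} s p⊆e (p-cols s s-inj)
    where
    p⊆e : Span p ⊆ Span e
    p⊆e = ⊆-trans (≐⇒⊆ p≐P) (⊆-trans P⊆E (≐⇒⊇ e≐E))

  -- For k = 0 the code P' is the zero space, so Z itself serves.
  common-𝒞-superspace : ∀ {t n} k {P P' Z : Sub n} → 𝒞 t n k P → 𝒞 t n k P' → Δ-adj t n k P P' →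
                        𝒞 t n (suc k) Z → P ⊆ Z → ∃[ E ] (𝒞 t n (suc k) E × P ⊆ E × P' ⊆ E)
  common-𝒞-superspace zero {Z = Z} _ (p' , (_ , p'≐P') , _) _ Z∈𝒞@(z , (_ , z≐Z) , _) P⊆Z =
    Z , Z∈𝒞 , P⊆Z , ⊆-trans (≐⇒⊇ p'≐P') (⊆-trans (Span-⊆ {b = p'} {z} (λ ())) (≐⇒⊆ z≐Z))
  common-𝒞-superspace (suc k) P∈𝒞 P'∈𝒞 P∩P'-dim _ _ =
    let e , e-ind , P⊆e , P'⊆e = common-superspace {k = k} (𝒞⇒HasDim P∈𝒞) (𝒞⇒HasDim P'∈𝒞) P∩P'-dim
    in Span e , 𝒞-superspace {e = e} P∈𝒞 (e-ind , ≐-refl) P⊆e , P⊆e , P'⊆e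

  Walk-respˡ-≐ : ∀ {n} {V : Sub n → Set (c ⊔ ℓ)} {A : Sub n → Sub n → Set (c ⊔ ℓ)} →
                 (∀ {X X' Y} → X ≐ X' → A X' Y → A X Y) →
                 ∀ {X X' Y l} → X ≐ X' → Walk V A X' Y l → Walk V A X Y l
  Walk-respˡ-≐ A-resp X≐X' (here X'≐Y) = here (≐-trans X≐X' X'≐Y)
  Walk-respˡ-≐ A-resp X≐X' (step Y∈V X'~Y walk) = step Y∈V (A-resp X≐X' X'~Y) walk

  Λ-adj-respˡ-≐ : ∀ {t n k} {X X' Y : Sub n} → X ≐ X' → Λ-adj t n k X' Y → Λ-adj t n k X Y
  Λ-adj-respˡ-≐ X≐X' = 𝒞-resp-≐ (≐-sym (∩-respˡ-≐ X≐X'))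

  Λ-step-or-stay : ∀ {t n k} {Z W P Y : Sub n} {l} →
                   𝒞 t n (suc k) Z → 𝒞 t n (suc k) W → 𝒞 t n k P → P ⊆ Z → P ⊆ W →
                   Walk (𝒞 t n (suc k)) (Λ-adj t n (suc k)) W Y l →
                   ∃[ l' ] (l' ≤ suc l × Walk (𝒞 t n (suc k)) (Λ-adj t n (suc k)) Z Y l')
  Λ-step-or-stay {t} {n} {k} {l = l} Z∈𝒞 W∈𝒞 P∈𝒞 P⊆Z P⊆W W⇝Y
    with equal-or-meet (𝒞⇒HasDim Z∈𝒞) (𝒞⇒HasDim W∈𝒞) (𝒞⇒HasDim P∈𝒞) P⊆Z P⊆W
  ... | inj₁ Z≐W   = l , n≤1+n l , Walk-respˡ-≐ (Λ-adj-respˡ-≐ {t} {n} {suc k}) Z≐W W⇝Y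
  ... | inj₂ Z∩W≐P = suc l , ≤-refl , step W∈𝒞 (𝒞-resp-≐ (≐-sym Z∩W≐P) P∈𝒞) W⇝Y

  lift-walk : ∀ {t n k} {P Q Z Y : Sub n} {l} → 𝒞 t n k P → Walk (𝒞 t n k) (Δ-adj t n k) P Q l →
              𝒞 t n (suc k) Z → P ⊆ Z → 𝒞 t n (suc k) Y → Q ⊆ Y →
              ∃[ l' ] (l' ≤ suc l × Walk (𝒞 t n (suc k)) (Λ-adj t n (suc k)) Z Y l')
  lift-walk P∈𝒞 (here P≐Q) Z∈𝒞 P⊆Z Y∈𝒞 Q⊆Y =
    Λ-step-or-stay Z∈𝒞 Y∈𝒞 P∈𝒞 P⊆Z (⊆-trans (≐⇒⊆ P≐Q) Q⊆Y) (here ≐-refl)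
  lift-walk {k = k} P∈𝒞 (step P'∈𝒞 P~P' P'⇝Q) Z∈𝒞 P⊆Z Y∈𝒞 Q⊆Y
    with common-𝒞-superspace k P∈𝒞 P'∈𝒞 P~P' Z∈𝒞 P⊆Z
  ... | E , E∈𝒞 , P⊆E , P'⊆E with lift-walk P'∈𝒞 P'⇝Q E∈𝒞 P'⊆E Y∈𝒞 Q⊆Y
  ... | l , l≤ , E⇝Y with Λ-step-or-stay Z∈𝒞 E∈𝒞 P∈𝒞 P⊆Z P⊆E E⇝Y
  ... | l' , l'≤ , Z⇝Y = l' , ≤-trans l'≤ (s≤s l≤) , Z⇝Y

  Injective? : ∀ {t n} (s : Fin t → Fin n) → Dec (Injective s)
  Injective? s = all? λ i → all? λ j → (s i ≟ᶠ s j) →-dec (i ≟ᶠ j)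

  AnyColumnsIndep? : ∀ {m n} t (b : Fin m → Vec n) → Dec (AnyColumnsIndep t b)
  AnyColumnsIndep? t b =
    searchable⇒∀? (λ s≗s' i → ≡.sym (s≗s' i)) (Vector-searchable ≡.refl Fin-searchable t) resp
                  (λ s → Injective? s →-dec LinIndep? _)
    where
    resp : (λ s → Injective s → ColumnsIndep b s) Respects Pointwise _≡_
    resp s≗s' s-cols s'-inj =
      LinIndep-resp (λ j i → reflexive (≡.cong (b i) (s≗s' j)))
                    (s-cols λ i j sᵢ≡sⱼ → s'-inj i j (≡.trans (≡.sym (s≗s' i)) (≡.trans sᵢ≡sⱼ (s≗s' j))))

  nonisolated⇒subcode : ∀ {t n k} {X : Sub n} → 𝒞 t n (suc k) X → ¬ Isolated t n (suc k) X →
                        ∃[ D ] (D ⊆ X × 𝒞 t n k D)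
  nonisolated⇒subcode {t} {n} {k} (x , (_ , x≐X) , _) nonisolated
    with Vector-searchable ≈ᵥ-refl (coefficients-searchable n) k Good resp Good?
    where
    Good : (Fin k → Vec n) → Set (c ⊔ ℓ)
    Good b = LinIndep b × (∀ i → Span x (b i)) × AnyColumnsIndep t b
    resp : Good Respects Pointwise _≈ᵥ_
    resp b≈b' (b-ind , b⊆x , b-cols) =
      LinIndep-resp b≈b' b-ind , (λ i → Span-resp {b = x} (b≈b' i) (b⊆x i)) ,
      λ s s-inj → LinIndep-resp (λ j i → b≈b' i (s j)) (b-cols s s-inj)
    Good? : Decidableᵘ Good
    Good? b = LinIndep? b ×-dec all? (λ i → Span? x (b i)) ×-dec AnyColumnsIndep? t b
  ... | yes (b , b-ind , b⊆x , b-cols) =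
          Span b , ⊆-trans (Span-⊆ {b = b} {x} b⊆x) (≐⇒⊆ x≐X) , b , (b-ind , ≐-refl) , b-cols
  ... | no no-good = ⊥-elim (nonisolated λ (D , D⊆X , b , (b-ind , b≐D) , b-cols) →
          no-good (b , b-ind , (λ i → ≐⇒⊇ x≐X (b i) (D⊆X (b i) (≐⇒⊆ b≐D (b i) (Span-generator b i)))) , b-cols))

  nonisolated-Λ-walk : ∀ {t n k} {X Y : Sub n} →
    𝒞 t n (suc k) X → ¬ Isolated t n (suc k) X → 𝒞 t n (suc k) Y → ¬ Isolated t n (suc k) Y →
    ∃[ D ] ∃[ D' ] (𝒞 t n k D × 𝒞 t n k D' ×
      (∀ {l} → Walk (𝒞 t n k) (Δ-adj t n k) D D' l →
               ∃[ l' ] (l' ≤ suc l × Walk (𝒞 t n (suc k)) (Λ-adj t n (suc k)) X Y l')))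
  nonisolated-Λ-walk X∈𝒞 X-nonisolated Y∈𝒞 Y-nonisolated =
    let D , D⊆X , D∈𝒞 = nonisolated⇒subcode X∈𝒞 X-nonisolated
        D' , D'⊆Y , D'∈𝒞 = nonisolated⇒subcode Y∈𝒞 Y-nonisolated
    in D , D' , D∈𝒞 , D'∈𝒞 , λ D⇝D' → lift-walk D∈𝒞 D⇝D' X∈𝒞 D⊆X Y∈𝒞 D'⊆Y

open import Data.Nat using (_<_; _∸_; _+_)
open import Data.Nat.Properties using (+-comm; ≤-reflexive)

corollary3p5 : ∀ {c ℓ} (F : Field c ℓ) (q : ℕ) → IsPrimePower q → HasSize F q →
    (n k t : ℕ) → 0 < k → k < n → t ≤ k →
    let open LinearCodes F in
    Connected (𝒞 t n (k ∸ 1)) (Δ-adj t n (k ∸ 1)) →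
    (∀ X Y → 𝒞 t n k X → ¬ Isolated t n k X → 𝒞 t n k Y → ¬ Isolated t n k Y →
       ∃[ l ] Walk (𝒞 t n k) (Λ-adj t n k) X Y l)
    × (∀ D → DiamAtMost (𝒞 t n (k ∸ 1)) (Δ-adj t n (k ∸ 1)) D →
       ∀ X Y → 𝒞 t n k X → ¬ Isolated t n k X → 𝒞 t n k Y → ¬ Isolated t n k Y →
       ∃[ l ] (l ≤ D + 1 × Walk (𝒞 t n k) (Λ-adj t n k) X Y l))
corollary3p5 F _ _ size n (suc k) t _ _ _ connected =
  (λ X Y X∈𝒞 X-nonisolated Y∈𝒞 Y-nonisolated →
    let D , D' , D∈𝒞 , D'∈𝒞 , lift = nonisolated-Λ-walk X∈𝒞 X-nonisolated Y∈𝒞 Y-nonisolated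
        l , D⇝D' = connected D D' D∈𝒞 D'∈𝒞
        l' , _ , X⇝Y = lift D⇝D'
    in l' , X⇝Y) ,
  (λ diam diam-bound X Y X∈𝒞 X-nonisolated Y∈𝒞 Y-nonisolated →
    let D , D' , D∈𝒞 , D'∈𝒞 , lift = nonisolated-Λ-walk X∈𝒞 X-nonisolated Y∈𝒞 Y-nonisolated
        l , l≤diam , D⇝D' = diam-bound D D' D∈𝒞 D'∈𝒞
        l' , l'≤1+l , X⇝Y = lift D⇝D'
    in l' , ≤-trans l'≤1+l (≤-trans (s≤s l≤diam) (≤-reflexive (+-comm 1 diam))) , X⇝Y)
  where open CodeGraphs F (HasSize⇒decidable F size) (HasSize⇒searchable F size)
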